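{- For each integer $k \ge 5$, there is an infinite family $\mathcal{G}_k$ of $k$-regular graphs such that every $G\in\mathcal{G}_k$ satisfies $\gamma_I^p(G)=|V(G)|$; in particular, the best constant $c$ such that $\gamma_I^p(G)\le c\,|V(G)|$ for all $G\in\mathcal{G}_k$ is $c=1$.
   Context: All graphs are finite, simple and undirected (not necessarily connected). For a graph $G=(V,E)$ and $v\in V$, $N(v)$ denotes the set of neighbours of $v$. A perfect Italian dominating function (PID-function) of $G$ is a function $f:V\to\{0,1,2\}$ such that for every vertex $v$ with $f(v)=0$ one has $\sum_{u\in N(v)} f(u)=2$. The weight of $f$ is $\sum_{v\in V} f(v)$. The perfect Italian domination number $\gamma_I^p(G)$ is the minimum weight of a PID-function of $G$. -}

module Defs where

open import Data.Nat using (ℕ; zero; suc; _+_; _≤_)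
open import Data.Fin using (Fin)
import Data.Fin as Fin
open import Data.Bool using (Bool; true; false; if_then_else_)
open import Relation.Binary.PropositionalEquality using (_≡_)
open import Data.Product using (_×_; Σ; ∃)

sumFin : (n : ℕ) → (Fin n → ℕ) → ℕ
sumFin zero    g = 0
sumFin (suc n) g = g Fin.zero + sumFin n (λ i → g (Fin.suc i))

record Graph (n : ℕ) : Set where
  field
    adj      : Fin n → Fin n → Bool
    symmetric : ∀ u v → adj u v ≡ adj v u
    irreflexive : ∀ v → adj v v ≡ false
open Graph public

degree : {n : ℕ} → Graph n → Fin n → ℕ
degree {n} G v = sumFin n (λ u → if adj G v u then 1 else 0)

Regular : {n : ℕ} → ℕ → Graph n → Set
Regular k G = ∀ v → degree G v ≡ k

nbrSum : {n : ℕ} → Graph n → (Fin n → ℕ) → Fin n → ℕ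
nbrSum {n} G f v = sumFin n (λ u → if adj G v u then f u else 0)

weight : {n : ℕ} → (Fin n → ℕ) → ℕ
weight {n} f = sumFin n f

IsPID : {n : ℕ} → Graph n → (Fin n → ℕ) → Set
IsPID G f = (∀ v → f v ≤ 2) × (∀ v → f v ≡ 0 → nbrSum G f v ≡ 2)

PIDNumberIs : {n : ℕ} → Graph n → ℕ → Set
PIDNumberIs G m =
  Σ _ (λ f → IsPID G f × weight f ≡ m) × (∀ f → IsPID G f → m ≤ weight f)

-- For q ≥ 0 let G be the join of C₅ᶜ and Cᶜ, the complements of a 5-cycle and of a
-- (q+3)-cycle; G is (q+5)-regular, and disjoint copies of G form the family.
-- γ_I^p(G) = |V(G)| says that no PID-function f of G takes the value 0. Suppose f(v) = 0.
-- Some vertex of Cᶜ has value 0, for otherwise Cᶜ alone carries weight ≥ 3 and no vertex of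
-- C₅ᶜ could be 0. Hence C₅ᶜ carries weight ≤ 2, and all its zeros have the same neighbourhood
-- sum inside C₅ᶜ; a finite check shows that f vanishes on C₅ᶜ. Then Cᶜ carries weight 2 and
-- each zero of Cᶜ sees all of it, so both of its cycle neighbours are 0. Thus the cycle
-- neighbours of a positive vertex are positive, and these three vertices weigh at least 3.

module Submission where

open import Defs
open import Data.Nat using (ℕ; zero; suc; _+_; _*_; _∸_; _≤_; _<_; _≤?_; z≤n; s≤s)
open import Data.Nat.Properties
open import Algebra.Properties.CommutativeSemigroup +-commutativeSemigroup using (interchange)
open import Data.Fin using (Fin; zero; suc; toℕ; fromℕ; inject₁; lower₁; _↑ˡ_; _↑ʳ_; splitAt)
import Data.Fin as Fin
open import Data.Fin.Patterns using (0F; 1F; 2F; 3F; 4F)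
open import Data.Fin.Properties
  using (any?; all?; toℕ-injective; toℕ<n; toℕ-fromℕ; toℕ-inject₁; inject₁-lower₁; lower₁-inject₁′;
         splitAt-↑ˡ; splitAt-↑ʳ; splitAt⁻¹-↑ˡ; splitAt⁻¹-↑ʳ)
open import Data.Bool using (Bool; true; false; if_then_else_; not)
open import Data.Product using (Σ; ∃; _×_; _,_)
open import Data.Sum using (_⊎_; inj₁; inj₂)
open import Data.Vec.Functional using ([]; _∷_)
open import Function using (_∘_; mk⇔)
open import Relation.Binary.PropositionalEquality
open import Relation.Nullary using (¬_; Dec; yes; no; does; contradiction)
open import Relation.Nullary.Decidable using (_⊎-dec_; _→-dec_; dec-true; does-⇔; from-yes)

private variable
  n a b : ℕ

sumFin-cong : {g h : Fin n → ℕ} → (∀ i → g i ≡ h i) → sumFin n g ≡ sumFin n h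
sumFin-cong {zero}  e = refl
sumFin-cong {suc n} e = cong₂ _+_ (e zero) (sumFin-cong (e ∘ suc))

sumFin-mono : {g h : Fin n → ℕ} → (∀ i → g i ≤ h i) → sumFin n g ≤ sumFin n h
sumFin-mono {zero}  e = z≤n
sumFin-mono {suc n} e = +-mono-≤ (e zero) (sumFin-mono (e ∘ suc))

sumFin-+ : (g h : Fin n → ℕ) → sumFin n (λ i → g i + h i) ≡ sumFin n g + sumFin n h
sumFin-+ {zero}  g h = refl
sumFin-+ {suc n} g h =
  trans (cong (g zero + h zero +_) (sumFin-+ (g ∘ suc) (h ∘ suc)))
        (interchange (g zero) (h zero) (sumFin n (g ∘ suc)) (sumFin n (h ∘ suc)))

sumFin-zero : ∀ n → sumFin n (λ _ → 0) ≡ 0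
sumFin-zero zero    = refl
sumFin-zero (suc n) = sumFin-zero n

sumFin-one : ∀ n → sumFin n (λ _ → 1) ≡ n
sumFin-one zero    = refl
sumFin-one (suc n) = cong suc (sumFin-one n)

sumFin-↑ : ∀ a {b} (g : Fin (a + b) → ℕ) →
  sumFin (a + b) g ≡ sumFin a (g ∘ (_↑ˡ b)) + sumFin b (g ∘ (a ↑ʳ_))
sumFin-↑ zero    g = refl
sumFin-↑ (suc a) g = trans (cong (g zero +_) (sumFin-↑ a (g ∘ suc))) (sym (+-assoc (g zero) _ _))

sumFin-select : (g : Fin n → ℕ) (w : Fin n) →
  sumFin n (λ v → if does (v Fin.≟ w) then g v else 0) ≡ g w
sumFin-select {suc n} g zero    =
  trans (cong (g zero +_) (sumFin-zero n)) (+-identityʳ (g zero))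
sumFin-select {suc n} g (suc w) = sumFin-select (g ∘ suc) w

if-partition : {A B C : Set} (a? : Dec A) (b? : Dec B) (c? : Dec C) →
  (A → ¬ B) → (A → ¬ C) → (B → ¬ C) → ∀ x →
  (if not (does (a? ⊎-dec b? ⊎-dec c?)) then x else 0)
    + ((if does a? then x else 0) + ((if does b? then x else 0) + (if does c? then x else 0)))
  ≡ x
if-partition (yes a) (yes b) _       a≠b _   _   x = contradiction b (a≠b a)
if-partition (yes a) (no _)  (yes c) _   a≠c _   x = contradiction c (a≠c a)
if-partition (yes _) (no _)  (no _)  _   _   _   x = +-identityʳ x
if-partition (no _)  (yes b) (yes c) _   _   b≠c x = contradiction c (b≠c b)
if-partition (no _)  (yes _) (no _)  _   _   _   x = +-identityʳ x
if-partition (no _)  (no _)  (yes _) _   _   _   x = refl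
if-partition (no _)  (no _)  (no _)  _   _   _   x = +-identityʳ x

≤-sumFin : (g : Fin n → ℕ) (i : Fin n) → g i ≤ sumFin n g
≤-sumFin g zero    = m≤m+n (g zero) _
≤-sumFin g (suc i) = ≤-trans (≤-sumFin (g ∘ suc) i) (m≤n+m _ (g zero))

sumFin<⇒∃≡0 : (g : Fin n → ℕ) → sumFin n g < n → ∃ λ i → g i ≡ 0
sumFin<⇒∃≡0 {n} g sum<n with any? (λ i → g i ≟ 0)
... | yes zero-exists = zero-exists
... | no  all-positive = contradiction n≤sum (<⇒≱ sum<n)
  where
  n≤sum : n ≤ sumFin n g
  n≤sum = subst (_≤ sumFin n g) (sumFin-one n)
                (sumFin-mono (λ i → n≢0⇒n>0 (λ gi≡0 → all-positive (i , gi≡0))))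

nbrSum+≤weight : (G : Graph n) (g : Fin n → ℕ) {w u : Fin n} →
  adj G w u ≡ false → nbrSum G g w + g u ≤ weight g
nbrSum+≤weight {n} G g {w} {u} w≁u = begin
  nbrSum G g w + g u                         ≡⟨ cong (nbrSum G g w +_) (sumFin-select g u) ⟨
  nbrSum G g w + sumFin n atU                ≡⟨ sumFin-+ _ atU ⟨
  sumFin n (λ v → nbrTerm v + atU v)         ≤⟨ sumFin-mono split ⟩
  weight g                                   ∎
  where
  open ≤-Reasoning
  nbrTerm atU : Fin n → ℕ
  nbrTerm v = if adj G w v then g v else 0
  atU     v = if does (v Fin.≟ u) then g v else 0
  split : ∀ v → nbrTerm v + atU v ≤ g v
  split v with v Fin.≟ u
  ... | yes refl rewrite w≁u = ≤-refl
  ... | no _ with adj G w v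
  ...   | true  = ≤-reflexive (+-identityʳ (g v))
  ...   | false = z≤n

nbrSum≤weight : (G : Graph n) (g : Fin n → ℕ) (w : Fin n) → nbrSum G g w ≤ weight g
nbrSum≤weight G g w = m+n≤o⇒m≤o _ (nbrSum+≤weight G g (irreflexive G w))

data Side (a b : ℕ) : Fin (a + b) → Set where
  left  : (x : Fin a) → Side a b (x ↑ˡ b)
  right : (y : Fin b) → Side a b (a ↑ʳ y)

side : ∀ a b (v : Fin (a + b)) → Side a b v
side a b v with splitAt a v in eq
... | inj₁ x = subst (Side a b) (splitAt⁻¹-↑ˡ eq) (left x)
... | inj₂ y = subst (Side a b) (splitAt⁻¹-↑ʳ eq) (right y)

module _ (cross : Bool) (G : Graph a) (H : Graph b) where

  private
    adj⊎ : Fin a ⊎ Fin b → Fin a ⊎ Fin b → Bool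
    adj⊎ (inj₁ x) (inj₁ y) = adj G x y
    adj⊎ (inj₁ x) (inj₂ y) = cross
    adj⊎ (inj₂ x) (inj₁ y) = cross
    adj⊎ (inj₂ x) (inj₂ y) = adj H x y

    adj⊎-sym : ∀ s t → adj⊎ s t ≡ adj⊎ t s
    adj⊎-sym (inj₁ x) (inj₁ y) = symmetric G x y
    adj⊎-sym (inj₁ x) (inj₂ y) = refl
    adj⊎-sym (inj₂ x) (inj₁ y) = refl
    adj⊎-sym (inj₂ x) (inj₂ y) = symmetric H x y

    adj⊎-irrefl : ∀ s → adj⊎ s s ≡ false
    adj⊎-irrefl (inj₁ x) = irreflexive G x
    adj⊎-irrefl (inj₂ y) = irreflexive H y

  glue : Graph (a + b)
  glue = record
    { adj         = λ u v → adj⊎ (splitAt a u) (splitAt a v)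
    ; symmetric   = λ u v → adj⊎-sym (splitAt a u) (splitAt a v)
    ; irreflexive = λ u → adj⊎-irrefl (splitAt a u)
    }

  private
    sumFin-if-cong : ∀ {m} (g : Fin m → ℕ) {c d : Fin m → Bool} → (∀ i → c i ≡ d i) →
      sumFin m (λ i → if c i then g i else 0) ≡ sumFin m (λ i → if d i then g i else 0)
    sumFin-if-cong g c≗d = sumFin-cong (λ i → cong (λ t → if t then g i else 0) (c≗d i))

  nbrSum-glue-↑ˡ : (f : Fin (a + b) → ℕ) (x : Fin a) →
    nbrSum glue f (x ↑ˡ b) ≡
    nbrSum G (f ∘ (_↑ˡ b)) x + sumFin b (λ y → if cross then f (a ↑ʳ y) else 0)
  nbrSum-glue-↑ˡ f x rewrite splitAt-↑ˡ a x b = trans (sumFin-↑ a _) (cong₂ _+_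
    (sumFin-if-cong (f ∘ (_↑ˡ b)) (λ y → cong (adj⊎ (inj₁ x)) (splitAt-↑ˡ a y b)))
    (sumFin-if-cong (f ∘ (a ↑ʳ_)) (λ y → cong (adj⊎ (inj₁ x)) (splitAt-↑ʳ a b y))))

  nbrSum-glue-↑ʳ : (f : Fin (a + b) → ℕ) (y : Fin b) →
    nbrSum glue f (a ↑ʳ y) ≡
    sumFin a (λ x → if cross then f (x ↑ˡ b) else 0) + nbrSum H (f ∘ (a ↑ʳ_)) y
  nbrSum-glue-↑ʳ f y rewrite splitAt-↑ʳ a b y = trans (sumFin-↑ a _) (cong₂ _+_
    (sumFin-if-cong (f ∘ (_↑ˡ b)) (λ x → cong (adj⊎ (inj₂ y)) (splitAt-↑ˡ a x b)))
    (sumFin-if-cong (f ∘ (a ↑ʳ_)) (λ x → cong (adj⊎ (inj₂ y)) (splitAt-↑ʳ a b x))))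

join disjointUnion : Graph a → Graph b → Graph (a + b)
join          = glue true
disjointUnion = glue false

module _ (G : Graph a) (H : Graph b) (f : Fin (a + b) → ℕ) where

  nbrSum-disjointUnion-↑ˡ : ∀ x → nbrSum (disjointUnion G H) f (x ↑ˡ b) ≡ nbrSum G (f ∘ (_↑ˡ b)) x
  nbrSum-disjointUnion-↑ˡ x = trans (nbrSum-glue-↑ˡ false G H f x)
    (trans (cong (nbrSum G (f ∘ (_↑ˡ b)) x +_) (sumFin-zero b)) (+-identityʳ _))

  nbrSum-disjointUnion-↑ʳ : ∀ y → nbrSum (disjointUnion G H) f (a ↑ʳ y) ≡ nbrSum H (f ∘ (a ↑ʳ_)) y
  nbrSum-disjointUnion-↑ʳ y = trans (nbrSum-glue-↑ʳ false G H f y)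
    (cong (_+ nbrSum H (f ∘ (a ↑ʳ_)) y) (sumFin-zero a))

disjointUnion-regular : ∀ {k} {G : Graph a} {H : Graph b} →
  Regular k G → Regular k H → Regular k (disjointUnion G H)
disjointUnion-regular {a} {b} {G = G} {H} regG regH v with side a b v
... | left  x = trans (nbrSum-disjointUnion-↑ˡ G H (λ _ → 1) x) (regG x)
... | right y = trans (nbrSum-disjointUnion-↑ʳ G H (λ _ → 1) y) (regH y)

PIDsPositive : Graph n → Set
PIDsPositive G = ∀ f → IsPID G f → ∀ v → f v ≢ 0

PIDsPositive⇒PIDNumberIs-order : (G : Graph n) → PIDsPositive G → PIDNumberIs G n
PIDsPositive⇒PIDNumberIs-order {n} G positive =
  (const1 , ((λ _ → s≤s z≤n) , (λ _ ())) , weight-const1) , weight-const1≤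
  where
  const1 : Fin n → ℕ
  const1 _ = 1
  weight-const1 : weight const1 ≡ n
  weight-const1 = sumFin-one n
  weight-const1≤ : ∀ f → IsPID G f → n ≤ weight f
  weight-const1≤ f pid = subst (_≤ weight f) weight-const1
    (sumFin-mono (λ v → n≢0⇒n>0 (positive f pid v)))

disjointUnion-PIDsPositive : {G : Graph a} {H : Graph b} →
  PIDsPositive G → PIDsPositive H → PIDsPositive (disjointUnion G H)
disjointUnion-PIDsPositive {a} {b} {G} {H} posG posH f (≤2 , perfect) v with side a b v
... | left x  = posG (f ∘ (_↑ˡ b)) ((λ _ → ≤2 _) ,
  λ x′ fx′≡0 → trans (sym (nbrSum-disjointUnion-↑ˡ G H f x′)) (perfect _ fx′≡0)) x
... | right y = posH (f ∘ (a ↑ʳ_)) ((λ _ → ≤2 _) ,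
  λ y′ fy′≡0 → trans (sym (nbrSum-disjointUnion-↑ʳ G H f y′)) (perfect _ fy′≡0)) y

edgeless₀ : Graph 0
edgeless₀ = record { adj = λ () ; symmetric = λ () ; irreflexive = λ () }

copies : Graph n → (t : ℕ) → Graph (t * n)
copies G zero    = edgeless₀
copies G (suc t) = disjointUnion G (copies G t)

copies-regular : ∀ {k} {G : Graph n} → Regular k G → ∀ t → Regular k (copies G t)
copies-regular regG zero    = λ ()
copies-regular regG (suc t) = disjointUnion-regular regG (copies-regular regG t)

copies-PIDsPositive : {G : Graph n} → PIDsPositive G → ∀ t → PIDsPositive (copies G t)
copies-PIDsPositive posG zero    = λ _ _ ()
copies-PIDsPositive posG (suc t) = disjointUnion-PIDsPositive posG (copies-PIDsPositive posG t)

-- A 2-regular graph with vertex set Fin n, given by the successor map along its cycles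
-- (all of length at least 3); its edges are the pairs {i, next i}.
record Rotation (n : ℕ) : Set where
  field
    next prev : Fin n → Fin n
    prev-next : ∀ i → prev (next i) ≡ i
    next-prev : ∀ i → next (prev i) ≡ i
    prev-≢    : ∀ i → prev i ≢ i
    prev²-≢   : ∀ i → prev (prev i) ≢ i

  next-≢ : ∀ i → next i ≢ i
  next-≢ i next≡i = prev-≢ i (trans (cong prev (sym next≡i)) (prev-next i))

  next≢prev : ∀ i → next i ≢ prev i
  next≢prev i next≡prev = prev²-≢ j (trans prev²j≡i (sym j≡i))
    where
    j : Fin n
    j = next (next i)
    j≡i : j ≡ i
    j≡i = trans (cong next next≡prev) (next-prev i)
    prev²j≡i : prev (prev j) ≡ i
    prev²j≡i = trans (cong prev (prev-next (next i))) (prev-next i)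

cycle : ∀ q → Rotation (3 + q)
cycle q = record
  { next = next ; prev = prev ; prev-next = prev-next ; next-prev = next-prev
  ; prev-≢ = prev-≢ ; prev²-≢ = prev²-≢ }
  where
  p : ℕ
  p = 2 + q

  prev : Fin (suc p) → Fin (suc p)
  prev zero    = fromℕ p
  prev (suc i) = inject₁ i

  next : Fin (suc p) → Fin (suc p)
  next i with p ≟ toℕ i
  ... | yes _   = zero
  ... | no  p≢i = suc (lower₁ i p≢i)

  prev-next : ∀ i → prev (next i) ≡ i
  prev-next i with p ≟ toℕ i
  ... | yes p≡i = toℕ-injective (trans (toℕ-fromℕ p) p≡i)
  ... | no  p≢i = inject₁-lower₁ i p≢i

  next-prev : ∀ i → next (prev i) ≡ i
  next-prev zero with p ≟ toℕ (fromℕ p)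
  ... | yes _   = refl
  ... | no  p≢p = contradiction (sym (toℕ-fromℕ p)) p≢p
  next-prev (suc i) with p ≟ toℕ (inject₁ i)
  ... | yes p≡i = contradiction (trans p≡i (toℕ-inject₁ i)) (<⇒≢ (toℕ<n i) ∘ sym)
  ... | no  p≢i = cong suc (lower₁-inject₁′ i p≢i)

  prev-≢ : ∀ i → prev i ≢ i
  prev-≢ zero    ()
  prev-≢ (suc i) eq = m≢1+n+m (toℕ i) {0} (trans (sym (toℕ-inject₁ i)) (cong toℕ eq))

  prev²-≢ : ∀ i → prev (prev i) ≢ i
  prev²-≢ zero          ()
  prev²-≢ (suc zero)    ()
  prev²-≢ (suc (suc i)) eq =
    m≢1+n+m (toℕ i) {1} (trans (sym (trans (toℕ-inject₁ (inject₁ i)) (toℕ-inject₁ i))) (cong toℕ eq))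

module _ (R : Rotation n) where
  open Rotation R

  private
    Near : Fin n → Fin n → Set
    Near w v = v ≡ w ⊎ v ≡ next w ⊎ v ≡ prev w

    near? : ∀ w v → Dec (Near w v)
    near? w v = v Fin.≟ w ⊎-dec v Fin.≟ next w ⊎-dec v Fin.≟ prev w

    Near-sym : ∀ {w v} → Near w v → Near v w
    Near-sym (inj₁ v≡w)        = inj₁ (sym v≡w)
    Near-sym (inj₂ (inj₁ v≡n)) = inj₂ (inj₂ (sym (trans (cong prev v≡n) (prev-next _))))
    Near-sym (inj₂ (inj₂ v≡p)) = inj₂ (inj₁ (sym (trans (cong next v≡p) (next-prev _))))

  cycleComplement : Graph n
  cycleComplement = record
    { adj         = λ w v → not (does (near? w v))
    ; symmetric   = λ w v → cong not (does-⇔ (mk⇔ Near-sym Near-sym) (near? w v) (near? v w))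
    ; irreflexive = λ v → cong not (dec-true (near? v v) (inj₁ refl))
    }

  nbrSum-cycleComplement : (f : Fin n → ℕ) (w : Fin n) →
    nbrSum cycleComplement f w + (f w + (f (next w) + f (prev w))) ≡ weight f
  nbrSum-cycleComplement f w = begin
    nbrSum cycleComplement f w + (f w + (f (next w) + f (prev w)))
      ≡⟨ cong (nbrSum cycleComplement f w +_)
              (cong₂ _+_ (sumFin-select f w) (cong₂ _+_ (sumFin-select f (next w)) (sumFin-select f (prev w)))) ⟨
    sumFin n far + (sumFin n (at w) + (sumFin n (at (next w)) + sumFin n (at (prev w))))
      ≡⟨ cong (λ t → sumFin n far + (sumFin n (at w) + t)) (sumFin-+ (at (next w)) (at (prev w))) ⟨
    sumFin n far + (sumFin n (at w) + sumFin n (λ v → at (next w) v + at (prev w) v))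
      ≡⟨ cong (sumFin n far +_) (sumFin-+ (at w) _) ⟨
    sumFin n far + sumFin n (λ v → at w v + (at (next w) v + at (prev w) v))
      ≡⟨ sumFin-+ far _ ⟨
    sumFin n (λ v → far v + (at w v + (at (next w) v + at (prev w) v)))
      ≡⟨ sumFin-cong (λ v → if-partition (v Fin.≟ w) (v Fin.≟ next w) (v Fin.≟ prev w)
            (λ v≡w v≡n → next-≢ w (trans (sym v≡n) v≡w))
            (λ v≡w v≡p → prev-≢ w (trans (sym v≡p) v≡w))
            (λ v≡n v≡p → next≢prev w (trans (sym v≡n) v≡p)) (f v)) ⟩
    weight f ∎
    where
    open ≡-Reasoning
    far : Fin n → ℕ
    far v = if adj cycleComplement w v then f v else 0
    at : Fin n → Fin n → ℕ
    at u v = if does (v Fin.≟ u) then f v else 0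

  cycleComplement-next≁ : ∀ y → adj cycleComplement (next y) y ≡ false
  cycleComplement-next≁ y = cong not (dec-true (near? (next y) y) (inj₂ (inj₂ (sym (prev-next y)))))

  cycleComplement-prev≁ : ∀ y → adj cycleComplement (prev y) y ≡ false
  cycleComplement-prev≁ y = cong not (dec-true (near? (prev y) y) (inj₂ (inj₁ (sym (next-prev y)))))

  cycleComplement-vanishes : (f : Fin n → ℕ) → weight f ≤ 2 →
    (∀ w → f w ≡ 0 → nbrSum cycleComplement f w ≡ weight f) → ∀ y → f y ≡ 0
  cycleComplement-vanishes f weight≤2 full y with f y in fy≡1+k
  ... | zero  = refl
  ... | suc k = contradiction (≤-trans 3≤triple (≤-trans triple≤weight weight≤2)) (<⇒≱ (s≤s ≤-refl))
    where
    1≤fy : 1 ≤ f y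
    1≤fy = subst (1 ≤_) (sym fy≡1+k) (s≤s z≤n)

    positive : ∀ {w} → adj cycleComplement w y ≡ false → 1 ≤ f w
    positive {w} w≁y = n≢0⇒n>0 λ fw≡0 → <⇒≱ 1≤fy (+-cancelˡ-≤ (weight f) (f y) 0 (begin
      weight f + f y                  ≡⟨ cong (_+ f y) (full w fw≡0) ⟨
      nbrSum cycleComplement f w + f y ≤⟨ nbrSum+≤weight cycleComplement f w≁y ⟩
      weight f                        ≡⟨ +-identityʳ (weight f) ⟨
      weight f + 0                    ∎))
      where open ≤-Reasoning

    3≤triple : 3 ≤ f y + (f (next y) + f (prev y))
    3≤triple = +-mono-≤ 1≤fy (+-mono-≤ (positive (cycleComplement-next≁ y)) (positive (cycleComplement-prev≁ y)))

    triple≤weight : f y + (f (next y) + f (prev y)) ≤ weight f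
    triple≤weight = subst (_ ≤_) (nbrSum-cycleComplement f y) (m≤n+m _ (nbrSum cycleComplement f y))

cycleComplement-regular : ∀ {q} (R : Rotation (3 + q)) → Regular q (cycleComplement R)
cycleComplement-regular {q} R w = +-cancelʳ-≡ 3 _ q (begin
  degree (cycleComplement R) w + 3 ≡⟨ nbrSum-cycleComplement R (λ _ → 1) w ⟩
  weight {3 + q} (λ _ → 1)         ≡⟨ sumFin-one (3 + q) ⟩
  3 + q                            ≡⟨ +-comm 3 q ⟩
  q + 3                            ∎)
  where open ≡-Reasoning

C₅ᶜ : Graph 5
C₅ᶜ = cycleComplement (cycle 2)

NbrSumsAgreeOnZeros : Graph n → (Fin n → ℕ) → Set
NbrSumsAgreeOnZeros G x = ∀ i j → x i ≡ 0 → x j ≡ 0 → nbrSum G x i ≡ nbrSum G x j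

private
  C₅ᶜ-Claim : (Fin 5 → ℕ) → Set
  C₅ᶜ-Claim x = weight x ≤ 2 → NbrSumsAgreeOnZeros C₅ᶜ x → weight x ≡ 0

  C₅ᶜ-claim? : ∀ x → Dec (C₅ᶜ-Claim x)
  C₅ᶜ-claim? x = weight x ≤? 2
    →-dec (all? λ i → all? λ j → x i ≟ 0 →-dec x j ≟ 0 →-dec nbrSum C₅ᶜ x i ≟ nbrSum C₅ᶜ x j)
    →-dec weight x ≟ 0

  C₅ᶜ-claim-below-3 : ∀ {a} → a < 3 → ∀ {b} → b < 3 → ∀ {c} → c < 3 → ∀ {d} → d < 3 → ∀ {e} → e < 3 →
    C₅ᶜ-Claim (a ∷ b ∷ c ∷ d ∷ e ∷ [])
  C₅ᶜ-claim-below-3 = from-yes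
    (allUpTo? (λ a → allUpTo? (λ b → allUpTo? (λ c → allUpTo? (λ d → allUpTo? (λ e →
      C₅ᶜ-claim? (a ∷ b ∷ c ∷ d ∷ e ∷ [])) 3) 3) 3) 3) 3)

-- The analogue fails on C₄ᶜ and C₆ᶜ (take 1010 and 100100): this is why a 5-cycle is used.
C₅ᶜ-weight≡0 : (x : Fin 5 → ℕ) → weight x ≤ 2 → NbrSumsAgreeOnZeros C₅ᶜ x → weight x ≡ 0
C₅ᶜ-weight≡0 x weight≤2 agree =
  C₅ᶜ-claim-below-3 (below 0F) (below 1F) (below 2F) (below 3F) (below 4F) weight≤2
    (λ i j xi≡0 xj≡0 → agree i j (trans (η i) xi≡0) (trans (η j) xj≡0))
  where
  below : ∀ i → x i < 3
  below i = s≤s (≤-trans (≤-sumFin x i) weight≤2)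
  η : ∀ i → x i ≡ (x 0F ∷ x 1F ∷ x 2F ∷ x 3F ∷ x 4F ∷ []) i
  η 0F = refl
  η 1F = refl
  η 2F = refl
  η 3F = refl
  η 4F = refl

module _ (q : ℕ) where

  private
    Cᶜ : Graph (3 + q)
    Cᶜ = cycleComplement (cycle q)

  base : Graph (5 + (3 + q))
  base = join C₅ᶜ Cᶜ

  base-regular : Regular (5 + q) base
  base-regular v with side 5 (3 + q) v
  ... | left  x = trans (nbrSum-glue-↑ˡ true C₅ᶜ Cᶜ (λ _ → 1) x)
    (cong₂ _+_ (cycleComplement-regular (cycle 2) x) (sumFin-one (3 + q)))
  ... | right y = trans (nbrSum-glue-↑ʳ true C₅ᶜ Cᶜ (λ _ → 1) y)
    (cong (5 +_) (cycleComplement-regular (cycle q) y))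

  base-PIDsPositive : PIDsPositive base
  base-PIDsPositive f (_ , perfect) v fv≡0 = contradiction (trans (sym SB≡2) SB≡0) λ ()
    where
    fA : Fin 5 → ℕ
    fA = f ∘ (_↑ˡ (3 + q))
    fB : Fin (3 + q) → ℕ
    fB = f ∘ (5 ↑ʳ_)
    SA SB : ℕ
    SA = weight fA
    SB = weight fB

    perfectA : ∀ x → fA x ≡ 0 → nbrSum C₅ᶜ fA x + SB ≡ 2
    perfectA x fx≡0 = trans (sym (nbrSum-glue-↑ˡ true C₅ᶜ Cᶜ f x)) (perfect _ fx≡0)

    perfectB : ∀ y → fB y ≡ 0 → SA + nbrSum Cᶜ fB y ≡ 2
    perfectB y fy≡0 = trans (sym (nbrSum-glue-↑ʳ true C₅ᶜ Cᶜ f y)) (perfect _ fy≡0)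

    zeroB : ∀ v → f v ≡ 0 → ∃ λ y → fB y ≡ 0
    zeroB v fv≡0 with side 5 (3 + q) v
    ... | left  x = sumFin<⇒∃≡0 fB (s≤s (≤-trans SB≤2 (m≤m+n 2 q)))
      where
      SB≤2 : SB ≤ 2
      SB≤2 = m+n≤o⇒n≤o (nbrSum C₅ᶜ fA x) (≤-reflexive (perfectA x fv≡0))
    ... | right y = y , fv≡0

    SA≡0 : SA ≡ 0
    SA≡0 = C₅ᶜ-weight≡0 fA SA≤2
      (λ i j fi≡0 fj≡0 → +-cancelʳ-≡ SB _ _ (trans (perfectA i fi≡0) (sym (perfectA j fj≡0))))
      where
      SA≤2 : SA ≤ 2
      SA≤2 with zeroB v fv≡0
      ... | y , fy≡0 = m+n≤o⇒m≤o SA (≤-reflexive (perfectB y fy≡0))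

    SB≡2 : SB ≡ 2
    SB≡2 = trans (cong (_+ SB) (sym nbr≡0)) (perfectA 0F f0≡0)
      where
      f0≡0 : fA 0F ≡ 0
      f0≡0 = n≤0⇒n≡0 (subst (fA 0F ≤_) SA≡0 (≤-sumFin fA 0F))
      nbr≡0 : nbrSum C₅ᶜ fA 0F ≡ 0
      nbr≡0 = n≤0⇒n≡0 (subst (nbrSum C₅ᶜ fA 0F ≤_) SA≡0 (nbrSum≤weight C₅ᶜ fA 0F))

    SB≡0 : SB ≡ 0
    SB≡0 = trans (sumFin-cong fB≡0) (sumFin-zero (3 + q))
      where
      fB≡0 : ∀ y → fB y ≡ 0
      fB≡0 = cycleComplement-vanishes (cycle q) fB (≤-reflexive SB≡2) λ y fy≡0 → begin
        nbrSum Cᶜ fB y      ≡⟨ cong (_+ nbrSum Cᶜ fB y) SA≡0 ⟨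
        SA + nbrSum Cᶜ fB y ≡⟨ perfectB y fy≡0 ⟩
        2                   ≡⟨ SB≡2 ⟨
        SB                  ∎
        where open ≡-Reasoning

theorem32 : (k : ℕ) → 5 ≤ k → (m : ℕ) →
    Σ ℕ (λ n → m ≤ n × Σ (Graph n) (λ G → Regular k G × PIDNumberIs G n))
theorem32 k 5≤k m =
  m * order , m≤m*n m order , copies (base q) m ,
  subst (λ d → Regular d (copies (base q) m)) (m+[n∸m]≡n 5≤k) (copies-regular (base-regular q) m) ,
  PIDsPositive⇒PIDNumberIs-order (copies (base q) m) (copies-PIDsPositive (base-PIDsPositive q) m)
  where
  q order : ℕ
  q     = k ∸ 5
  order = 5 + (3 + q)
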